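{- Let $G$ be a graph, let $\prec$ be a linear ordering of its vertices, let $m\ge 1$ be an integer, and let $X\subseteq V(G)$. Let $C$ be a set of vertices of $G^{[\prec,m]/X}$. If $x,y\in X$ belong to different components of $G^{[\prec,m]/X}-C$, then $d_{G-C}(x,y)>m$.
   Context: For a linear ordering $\prec$ of $V(G)$, a vertex $v$ and integer $m\ge0$, $L^\prec_m(v)$ is the set of vertices $u$ such that there is a path $P$ in $G$ from $v$ to $u$ with at most $m$ edges and $u\preceq x$ for all $x\in V(P)$ (so $v\in L^\prec_m(v)$). The graph $G^{[\prec,m]}$ has vertex set $V(G)$ and edges $uv$ for all $v\in V(G)$ and $u\in L^\prec_m(v)$ with $u\ne v$. For $X\subseteq V(G)$, $G^{[\prec,m]/X}$ is the induced subgraph of $G^{[\prec,m]}$ with vertex set $\bigcup_{x\in X}L^\prec_m(x)$. $d_H(x,y)$ denotes the distance in $H$ (infinite if no path exists). -}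

module Defs where

open import Data.Nat using (ℕ; _≤_; _>_)
open import Data.Fin using (Fin; toℕ)
open import Data.List using (List; []; _∷_; length; head; last)
open import Data.List.Relation.Unary.All using (All)
open import Data.List.Relation.Unary.AllPairs using (AllPairs)
open import Data.List.Relation.Unary.Unique.Propositional using (Unique)
open import Data.Maybe using (just)
open import Data.Product using (Σ; _×_; ∃)
open import Data.Empty using (⊥)
open import Relation.Binary.PropositionalEquality using (_≡_; _≢_)
open import Relation.Nullary using (¬_)
open import Data.Fin.Permutation using (Permutation′; _⟨$⟩ʳ_)

record Graph (n : ℕ) : Set₁ where
  field
    Adj     : Fin n → Fin n → Set
    sym     : ∀ {u v} → Adj u v → Adj v u
    irrefl  : ∀ {u} → ¬ Adj u u
open Graph public

Rel : ℕ → Set₁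
Rel n = Fin n → Fin n → Set

VSet : ℕ → Set₁
VSet n = Fin n → Set

data Chain {n : ℕ} (E : Rel n) : List (Fin n) → Set where
  []  : Chain E []
  [-] : ∀ v → Chain E (v ∷ [])
  _∷_ : ∀ {u v vs} → E u v → Chain E (v ∷ vs) → Chain E (u ∷ v ∷ vs)

record IsPath {n : ℕ} (E : Rel n) (S : VSet n) (a b : Fin n) (P : List (Fin n)) : Set where
  field
    chain  : Chain E P
    unique : Unique P
    inS    : All S P
    start  : head P ≡ just a
    end    : last P ≡ just b

-- number of edges of a (nonempty) path = length - 1; "at most m edges" is
-- length P ≤ m + 1.
open import Data.Nat using (suc)

AllV : {n : ℕ} → VSet n
AllV _ = Data.Unit.⊤ where import Data.Unit

-- Linear ordering on Fin n given by a permutation σ (rank function):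
-- u ≼ v iff σ(u) ≤ σ(v). Every linear order on a finite set arises this way.
Order : ℕ → Set
Order n = Permutation′ n

_≼[_]_ : {n : ℕ} → Fin n → Order n → Fin n → Set
u ≼[ σ ] v = toℕ (σ ⟨$⟩ʳ u) ≤ toℕ (σ ⟨$⟩ʳ v)

L : {n : ℕ} → Graph n → Order n → ℕ → Fin n → VSet n
L G σ m v u = Σ (List _) λ P →
  IsPath (Adj G) AllV v u P × length P ≤ suc m × All (λ x → u ≼[ σ ] x) P

GOrd : {n : ℕ} → Graph n → Order n → ℕ → Rel n
GOrd G σ m a b = (a ≢ b × L G σ m b a) Data.Sum.⊎ (a ≢ b × L G σ m a b)
  where import Data.Sum

-- Vertex set of G^{[≺,m]/X}: union of L(x) over x ∈ X.
VOrdX : {n : ℕ} → Graph n → Order n → ℕ → VSet n → VSet n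
VOrdX G σ m X u = Σ (Fin _) λ x → X x × L G σ m x u

Connected : {n : ℕ} → Rel n → VSet n → Fin n → Fin n → Set
Connected E S a b = Σ (List _) λ P → IsPath E S a b P

_∖_ : {n : ℕ} → VSet n → VSet n → VSet n
(S ∖ C) v = S v × ¬ C v

DistGreater : {n : ℕ} → Graph n → VSet n → Fin n → Fin n → ℕ → Set
DistGreater G C x y m = ¬ (Σ (List _) λ P →
  IsPath (Adj G) (AllV ∖ C) x y P × length P ≤ suc m)

-- Suppose P is a path of G - C from x to y with at most m edges, and let z be
-- the ≺-least vertex of P.  The part of P from x to z is a path with at most m
-- edges all of whose vertices are ≽ z, so z ∈ L_m(x); reading P backwards gives
-- z ∈ L_m(y) in the same way.  Since z lies on P, z ∉ C, and x, y ∈ L_m(x),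
-- L_m(y) trivially; hence x, z, y are vertices of G^{[≺,m]/X} - C and
-- x – z – y (with repetitions removed) is a path there, contradicting the
-- assumption that x and y lie in different components.
module Submission where

open import Defs hiding (sym)
open import Data.Nat using (ℕ; _≥_; _≤_; suc; z≤n; s≤s)
open import Data.Nat.Properties using (≤-refl; ≤-trans; ≤-reflexive)
open import Data.Fin using (Fin; toℕ)
open import Data.Fin.Properties using (_≟_)
open import Data.Fin.Permutation using (_⟨$⟩ʳ_)
open import Data.List using (List; []; _∷_; length; head; last; reverse; reverseAcc)
open import Data.List.Properties using (length-reverse; reverse-involutive)
open import Data.List.Relation.Unary.All as All using (All; []; _∷_)
open import Data.List.Relation.Unary.Any using (here; there)
open import Data.List.Relation.Unary.Any.Properties using () renaming (reverse⁺ to ∈-reverse⁺; reverse⁻ to ∈-reverse⁻)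
open import Data.List.Relation.Unary.Unique.Propositional using (Unique)
open import Data.List.Relation.Unary.AllPairs using ([]; _∷_)
open import Data.List.Relation.Binary.Permutation.Setoid using (↭-sym)
open import Data.List.Relation.Binary.Permutation.Setoid.Properties using (Unique-resp-↭; ↭-reverse)
open import Data.List.Relation.Binary.Sublist.Propositional using (_⊆_; []; _∷_; _∷ʳ_; ⊆-refl; minimum)
open import Data.List.Relation.Binary.Sublist.Propositional.Properties using (All-resp-⊆)
open import Data.List.Relation.Binary.Sublist.Heterogeneous.Properties using (length-mono-≤)
open import Data.List.Membership.Propositional using (_∈_)
open import Data.List.Extrema.Nat using (argmin; argmin-sel; f[argmin]≤f[⊤]; f[argmin]≤f[xs])
open import Data.Maybe using (just)
open import Data.Product using (Σ; _×_; _,_; proj₂)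
open import Data.Sum using (inj₁; inj₂)
open import Data.Unit using (tt)
open import Relation.Nullary using (¬_; yes; no)
open import Relation.Binary.PropositionalEquality
  using (_≡_; _≢_; refl; sym; trans; cong; setoid; module ≡-Reasoning)

Unique-resp-⊆ : ∀ {A : Set} {xs ys : List A} → xs ⊆ ys → Unique ys → Unique xs
Unique-resp-⊆ []          u          = u
Unique-resp-⊆ (y ∷ʳ xs⊆ys) (_ ∷ u)   = Unique-resp-⊆ xs⊆ys u
Unique-resp-⊆ (refl ∷ xs⊆ys) (y∉ ∷ u) = All-resp-⊆ xs⊆ys y∉ ∷ Unique-resp-⊆ xs⊆ys u

Unique-reverse : ∀ {A : Set} (xs : List A) → Unique xs → Unique (reverse xs)
Unique-reverse {A} xs = Unique-resp-↭ (setoid A) (↭-sym (setoid A) (↭-reverse (setoid A) xs))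

All-reverse : ∀ {A : Set} {P : A → Set} {xs : List A} → All P xs → All P (reverse xs)
All-reverse ps = All.tabulate (λ x∈ → All.lookup ps (∈-reverse⁻ x∈))

head-reverse : ∀ {A : Set} (xs : List A) → head (reverse xs) ≡ last xs
head-reverse []       = refl
head-reverse (x ∷ xs) = go x xs []
  where
  go : ∀ {A : Set} (x : A) xs acc → head (reverseAcc acc (x ∷ xs)) ≡ last (x ∷ xs)
  go x []       acc = refl
  go x (y ∷ ys) acc = go y ys (x ∷ acc)

last-reverse : ∀ {A : Set} (xs : List A) → last (reverse xs) ≡ head xs
last-reverse xs = begin
  last (reverse xs)           ≡⟨ sym (head-reverse (reverse xs)) ⟩
  head (reverse (reverse xs)) ≡⟨ cong head (reverse-involutive xs) ⟩
  head xs                     ∎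
  where open ≡-Reasoning

least-element : ∀ {A : Set} (rank : A → ℕ) (v : A) (vs : List A) →
  Σ A λ z → z ∈ v ∷ vs × All (λ u → rank z ≤ rank u) (v ∷ vs)
least-element rank v vs = z , z∈ , f[argmin]≤f[⊤] {f = rank} v vs ∷ f[argmin]≤f[xs] {f = rank} v vs
  where
  z = argmin rank v vs
  z∈ : z ∈ v ∷ vs
  z∈ with argmin-sel rank v vs
  ... | inj₁ z≡v  = here z≡v
  ... | inj₂ z∈vs = there z∈vs

module _ {n : ℕ} {E : Rel n} where

  chain-prefix : ∀ {v vs z} → Chain E (v ∷ vs) → z ∈ v ∷ vs →
    Σ (List (Fin n)) λ Q → Chain E (v ∷ Q) × (v ∷ Q) ⊆ (v ∷ vs) × last (v ∷ Q) ≡ just z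
  chain-prefix {v} {vs} c (here refl) = [] , [-] v , refl ∷ minimum vs , refl
  chain-prefix {vs = w ∷ ws} (e ∷ c) (there z∈) with chain-prefix c z∈
  ... | Q , cQ , Q⊆ , lastQ = w ∷ Q , e ∷ cQ , refl ∷ Q⊆ , lastQ

  path-prefix : ∀ {S a b z P} → IsPath E S a b P → z ∈ P →
    Σ (List (Fin n)) λ Q → IsPath E S a z Q × Q ⊆ P
  path-prefix {P = []} p ()
  path-prefix {S} {z = z} {P = v ∷ vs} p z∈ with IsPath.start p
  ... | refl with chain-prefix (IsPath.chain p) z∈
  ...   | Q , cQ , Q⊆ , lastQ = v ∷ Q , path , Q⊆
    where
    path : IsPath E S v z (v ∷ Q)
    path = record { chain = cQ ; unique = Unique-resp-⊆ Q⊆ (IsPath.unique p)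
                  ; inS = All-resp-⊆ Q⊆ (IsPath.inS p) ; start = refl ; end = lastQ }

  module _ (E-sym : ∀ {u v} → E u v → E v u) where

    chain-reverse : ∀ {vs} → Chain E vs → Chain E (reverse vs)
    chain-reverse []        = []
    chain-reverse ([-] v)   = [-] v
    chain-reverse (e ∷ c)   = onto c (E-sym e ∷ [-] _)
      where
      onto : ∀ {u xs acc} → Chain E (u ∷ xs) → Chain E (u ∷ acc) →
             Chain E (reverseAcc (u ∷ acc) xs)
      onto ([-] _) d = d
      onto (e′ ∷ c′) d = onto c′ (E-sym e′ ∷ d)

    path-reverse : ∀ {S a b P} → IsPath E S a b P → IsPath E S b a (reverse P)
    path-reverse {P = P} p = record
      { chain  = chain-reverse chain
      ; unique = Unique-reverse P unique
      ; inS    = All-reverse inS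
      ; start  = trans (head-reverse P) end
      ; end    = trans (last-reverse P) start
      }
      where open IsPath p

  path-mono : ∀ {S T : VSet n} {a b P} → (∀ {v} → S v → T v) →
    IsPath E S a b P → IsPath E T a b P
  path-mono S⊆T p = record
    { chain = chain ; unique = unique ; inS = All.map S⊆T inS ; start = start ; end = end }
    where open IsPath p

  connected-refl : ∀ {S a} → S a → Connected E S a a
  connected-refl Sa = _ , record
    { chain = [-] _ ; unique = [] ∷ [] ; inS = Sa ∷ [] ; start = refl ; end = refl }

  connected-edge : ∀ {S a b} → S a → S b → a ≢ b → E a b → Connected E S a b
  connected-edge Sa Sb a≢b e = _ , record
    { chain = e ∷ [-] _ ; unique = (a≢b ∷ []) ∷ [] ∷ []
    ; inS = Sa ∷ Sb ∷ [] ; start = refl ; end = refl }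

  connected-two-edges : ∀ {S a z b} → S a → S z → S b →
    a ≢ z → a ≢ b → z ≢ b → E a z → E z b → Connected E S a b
  connected-two-edges Sa Sz Sb a≢z a≢b z≢b e f = _ , record
    { chain = e ∷ f ∷ [-] _ ; unique = (a≢z ∷ a≢b ∷ []) ∷ (z≢b ∷ []) ∷ [] ∷ []
    ; inS = Sa ∷ Sz ∷ Sb ∷ [] ; start = refl ; end = refl }

module _ {n : ℕ} (G : Graph n) (σ : Order n) (m : ℕ) where

  L-refl : ∀ v → L G σ m v v
  L-refl v = v ∷ [] , proj₂ (connected-refl tt) , s≤s z≤n , ≤-refl ∷ []

  L-from-path : ∀ {S a b z P} → IsPath (Adj G) S a b P → length P ≤ suc m →
    z ∈ P → All (z ≼[ σ ]_) P → L G σ m a z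
  L-from-path P-path P-short z∈ z-min with path-prefix P-path z∈
  ... | Q , Q-path , Q⊆ =
    Q , path-mono (λ _ → tt) Q-path , ≤-trans (length-mono-≤ Q⊆) P-short , All-resp-⊆ Q⊆ z-min

  least-vertex-in-L : ∀ {S a b P} → IsPath (Adj G) S a b P → length P ≤ suc m →
    Σ (Fin n) λ z → z ∈ P × L G σ m a z × L G σ m b z
  least-vertex-in-L {P = []} p _ with IsPath.start p
  ... | ()
  least-vertex-in-L {P = v ∷ vs} p short with least-element (λ u → toℕ (σ ⟨$⟩ʳ u)) v vs
  ... | z , z∈ , z-min =
    z , z∈ , L-from-path p short z∈ z-min
      , L-from-path (path-reverse (Graph.sym G) p)
                    (≤-trans (≤-reflexive (length-reverse (v ∷ vs))) short)
                    (∈-reverse⁺ z∈) (All-reverse z-min)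

  connected-via-common : ∀ {S : VSet n} {a z b} → S a → S z → S b →
    L G σ m a z → L G σ m b z → Connected (GOrd G σ m) S a b
  connected-via-common {a = a} {z} {b} Sa Sz Sb Laz Lbz with a ≟ b | z ≟ a | z ≟ b
  ... | yes refl | _        | _        = connected-refl Sa
  ... | no a≢b   | yes refl | _        = connected-edge Sa Sb a≢b (inj₁ (a≢b , Lbz))
  ... | no a≢b   | no _     | yes refl = connected-edge Sa Sb a≢b (inj₂ (a≢b , Laz))
  ... | no a≢b   | no z≢a   | no z≢b   =
    connected-two-edges Sa Sz Sb a≢z a≢b z≢b (inj₂ (a≢z , Laz)) (inj₁ (z≢b , Lbz))
    where
    a≢z : a ≢ z
    a≢z a≡z = z≢a (sym a≡z)

lemma10 : (n : ℕ) (G : Graph n) (σ : Order n) (m : ℕ) → m ≥ 1 →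
    (X C : VSet n) →
    (∀ v → C v → VOrdX G σ m X v) →
    (x y : Fin n) → X x → X y → ¬ C x → ¬ C y →
    ¬ Connected (GOrd G σ m) (VOrdX G σ m X ∖ C) x y →
    DistGreater G C x y m
lemma10 n G σ m _ X C _ x y Xx Xy x∉C y∉C separated (P , P-path , P-short)
  with least-vertex-in-L G σ m P-path P-short
... | z , z∈P , Lxz , Lyz = separated (connected-via-common G σ m x-in z-in y-in Lxz Lyz)
  where
  x-in : (VOrdX G σ m X ∖ C) x
  x-in = (x , Xx , L-refl G σ m x) , x∉C
  y-in : (VOrdX G σ m X ∖ C) y
  y-in = (y , Xy , L-refl G σ m y) , y∉C
  z-in : (VOrdX G σ m X ∖ C) z
  z-in = (x , Xx , Lxz) , proj₂ (All.lookup (IsPath.inS P-path) z∈P)
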